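{- Every submatrix of a fully interlacing matrix of formal power series in $\mathbb{R}[[x]]$ is fully interlacing.
   Context: A $\mathbb{Z}\times\mathbb{Z}$ real matrix is totally positive (TP) if every finite square submatrix has nonnegative determinant. For a $p\times q$ matrix $\mathcal{A} = (A_{ij}(x))_{0\le i<p,\,0\le j<q}$ of formal power series $A_{ij}(x) = \sum_{n\ge 0} a_{ij}(n)x^n \in\mathbb{R}[[x]]$ (with $a_{ij}(n) = 0$ for $n<0$), $\mathrm{Lace}(\mathcal{A}) = (M_{uv})_{u,v\in\mathbb{Z}}$ is defined by writing $u = pu'+i$, $v = qv'+j$ with $u',v'\in\mathbb{Z}$, $0\le i<p$, $0\le j<q$, and setting $M_{uv} = a_{ij}(v'-u')$. $\mathcal{A}$ is fully interlacing if $\mathrm{Lace}(\mathcal{A})$ is TP. A submatrix of $\mathcal{A}$ is obtained by selecting some rows and some columns (keeping their order). -}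

module Defs where

open import Level using (0ℓ)
open import Data.Product using (Σ; ∃; _×_; _,_)
open import Data.Empty using (⊥)
open import Relation.Nullary using (¬_)
open import Relation.Binary.PropositionalEquality using (_≡_)
open import Relation.Binary.Structures using (IsTotalOrder)
open import Algebra.Structures using (IsCommutativeRing)
open import Data.Nat as ℕ using (ℕ; zero; suc; NonZero)
open import Data.Fin as Fin using (Fin; punchIn; fromℕ<; toℕ)
open import Data.Integer as ℤ using (ℤ; +_; -[1+_])
open import Data.Integer.DivMod using (n%ℕd<d)

-- The real numbers, given axiomatically as a Dedekind-complete ordered
-- field.  Any two such structures are isomorphic, so quantifying over
-- all of them is the same as speaking about ℝ.

record RealField : Set₁ where
  infixl 6 _+_
  infixl 7 _*_
  infix  4 _≤_
  field
    Carrier : Set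
    _+_ _*_ : Carrier → Carrier → Carrier
    -_      : Carrier → Carrier
    0# 1#   : Carrier
    _≤_     : Carrier → Carrier → Set
    isCommutativeRing : IsCommutativeRing _≡_ _+_ _*_ -_ 0# 1#
    isTotalOrder      : IsTotalOrder _≡_ _≤_
    0≢1      : ¬ (0# ≡ 1#)
    inverse  : ∀ x → ¬ (x ≡ 0#) → ∃ λ y → x * y ≡ 1#
    +-mono-≤ : ∀ {x y} z → x ≤ y → x + z ≤ y + z
    *-nonneg : ∀ {x y} → 0# ≤ x → 0# ≤ y → 0# ≤ x * y
    complete : (S : Carrier → Set) → (∃ λ x → S x) →
               (∃ λ b → ∀ x → S x → x ≤ b) →
               ∃ λ s → (∀ x → S x → x ≤ s) ×
                       (∀ b → (∀ x → S x → x ≤ b) → s ≤ b)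

module WithReals (ℝ : RealField) where
  open RealField ℝ

  sumFin : ∀ {n} → (Fin n → Carrier) → Carrier
  sumFin {zero}  f = 0#
  sumFin {suc n} f = f Fin.zero + sumFin (λ i → f (Fin.suc i))

  sign : ℕ → Carrier
  sign zero    = 1#
  sign (suc k) = - sign k

  det : ∀ {n} → (Fin n → Fin n → Carrier) → Carrier
  det {zero}  M = 1#
  det {suc n} M = sumFin λ j →
    sign (toℕ j) * (M Fin.zero j * det (λ i k → M (Fin.suc i) (punchIn j k)))

  IncreasingInℤ : ∀ {k} → (Fin k → ℤ) → Set
  IncreasingInℤ r = ∀ i j → i Fin.< j → r i ℤ.< r j

  IncreasingInFin : ∀ {k m} → (Fin k → Fin m) → Set
  IncreasingInFin f = ∀ i j → i Fin.< j → f i Fin.< f j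

  TotallyPositive : (ℤ → ℤ → Carrier) → Set
  TotallyPositive M = ∀ (k : ℕ) (r c : Fin k → ℤ) →
    IncreasingInℤ r → IncreasingInℤ c →
    0# ≤ det (λ i j → M (r i) (c j))

  PowerSeries : Set
  PowerSeries = ℕ → Carrier

  coeff : PowerSeries → ℤ → Carrier
  coeff a (+ n)    = a n
  coeff a -[1+ n ] = 0#

  -- Lace of a p×q matrix of power series:  u = p u' + i, v = q v' + j,
  -- M_{uv} = a_{ij}(v' − u')
  Lace : ∀ {p q} .{{_ : NonZero p}} .{{_ : NonZero q}} →
         (Fin p → Fin q → PowerSeries) → ℤ → ℤ → Carrier
  Lace {p} {q} A u v =
    coeff (A (fromℕ< (n%ℕd<d u p)) (fromℕ< (n%ℕd<d v q)))
          ((v ℤ./ℕ q) ℤ.- (u ℤ./ℕ p))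

  FullyInterlacing : ∀ {p q} .{{_ : NonZero p}} .{{_ : NonZero q}} →
                     (Fin p → Fin q → PowerSeries) → Set
  FullyInterlacing A = TotallyPositive (Lace A)

{-# OPTIONS --safe #-}
-- Writing u = p′ u′ + i with 0 ≤ i < p′, row u of Lace (A ∘ (f , g)) is row
-- p u′ + f i of Lace A, and likewise for columns.  Ordering ℤ lexicographically
-- by (quotient, remainder) shows that u ↦ p u′ + f i is strictly increasing
-- when f is, so every square submatrix of the new Lace is one of Lace A.
module Submission where

open import Defs
open import Data.Nat using (NonZero)
open import Data.Fin using (Fin)

open import Data.Nat as ℕ using (ℕ)
import Data.Fin as Fin
import Data.Fin.Properties as FinP
open import Data.Integer as ℤ using (ℤ; +_; +<+; _/ℕ_; _%ℕ_)
import Data.Integer.Properties as ℤP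
open import Data.Integer.DivMod using (n%ℕd<d; a≡a%ℕn+[a/ℕn]*n)
open import Data.Product using (_×_; _,_; proj₁; proj₂)
open import Data.Sum using (_⊎_; inj₁; inj₂)
open import Data.Empty using (⊥-elim)
open import Relation.Binary.Core using (_Preserves_⟶_)
open import Relation.Binary.Definitions using (tri<; tri≈; tri>)
open import Relation.Binary.PropositionalEquality

fromQuotRem : (d : ℕ) → ℤ → Fin d → ℤ
fromQuotRem d q i = + Fin.toℕ i ℤ.+ q ℤ.* + d

module _ {d : ℕ} where

  fromQuotRem-monoˡ-< : ∀ {q q′} (i j : Fin d) → q ℤ.< q′ →
                        fromQuotRem d q i ℤ.< fromQuotRem d q′ j
  fromQuotRem-monoˡ-< {q} {q′} i j q<q′ = begin-strict
    + Fin.toℕ i ℤ.+ q ℤ.* + d  <⟨ ℤP.+-monoˡ-< (q ℤ.* + d) (+<+ (FinP.toℕ<n i)) ⟩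
    + d ℤ.+ q ℤ.* + d          ≡⟨ ℤP.suc-* q (+ d) ⟨
    ℤ.suc q ℤ.* + d            ≤⟨ ℤP.*-monoʳ-≤-nonNeg (+ d) (ℤP.i<j⇒suc[i]≤j q<q′) ⟩
    q′ ℤ.* + d                 ≤⟨ ℤP.i≤j+i (q′ ℤ.* + d) (+ Fin.toℕ j) ⟩
    + Fin.toℕ j ℤ.+ q′ ℤ.* + d ∎
    where open ℤP.≤-Reasoning

  fromQuotRem-monoʳ-< : ∀ q {i j : Fin d} → i Fin.< j →
                        fromQuotRem d q i ℤ.< fromQuotRem d q j
  fromQuotRem-monoʳ-< q i<j = ℤP.+-monoˡ-< (q ℤ.* + d) (+<+ i<j)

  fromQuotRem-injective : ∀ {q q′} {i j : Fin d} →
                          fromQuotRem d q i ≡ fromQuotRem d q′ j → q ≡ q′ × i ≡ j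
  fromQuotRem-injective {q} {q′} {i} {j} eq with ℤP.<-cmp q q′ | FinP.<-cmp i j
  ... | tri< q<q′ _ _ | _ = ⊥-elim (ℤP.<⇒≢ (fromQuotRem-monoˡ-< i j q<q′) eq)
  ... | tri> _ _ q>q′ | _ = ⊥-elim (ℤP.<⇒≢ (fromQuotRem-monoˡ-< j i q>q′) (sym eq))
  ... | tri≈ _ refl _ | tri< i<j _ _ = ⊥-elim (ℤP.<⇒≢ (fromQuotRem-monoʳ-< q i<j) eq)
  ... | tri≈ _ refl _ | tri≈ _ i≡j _ = refl , i≡j
  ... | tri≈ _ refl _ | tri> _ _ i>j = ⊥-elim (ℤP.<⇒≢ (fromQuotRem-monoʳ-< q i>j) (sym eq))

  fromQuotRem-cancel-< : ∀ {q q′} {i j : Fin d} →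
                         fromQuotRem d q i ℤ.< fromQuotRem d q′ j →
                         q ℤ.< q′ ⊎ (q ≡ q′ × i Fin.< j)
  fromQuotRem-cancel-< {q} {q′} {i} {j} lt with ℤP.<-cmp q q′ | FinP.<-cmp i j
  ... | tri< q<q′ _ _ | _ = inj₁ q<q′
  ... | tri> _ _ q>q′ | _ = ⊥-elim (ℤP.<-asym lt (fromQuotRem-monoˡ-< j i q>q′))
  ... | tri≈ _ q≡q′ _ | tri< i<j _ _ = inj₂ (q≡q′ , i<j)
  ... | tri≈ _ refl _ | tri≈ _ refl _ = ⊥-elim (ℤP.<-irrefl refl lt)
  ... | tri≈ _ refl _ | tri> _ _ i>j = ⊥-elim (ℤP.<-asym lt (fromQuotRem-monoʳ-< q i>j))

-- Definitionally the index into A that Lace computes, so Lace unfolds through it.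
remFin : (d : ℕ) .{{_ : NonZero d}} → ℤ → Fin d
remFin d u = Fin.fromℕ< (n%ℕd<d u d)

module _ {d : ℕ} .{{_ : NonZero d}} where

  fromQuotRem-/ℕ-remFin : ∀ u → fromQuotRem d (u /ℕ d) (remFin d u) ≡ u
  fromQuotRem-/ℕ-remFin u = begin
    + Fin.toℕ (remFin d u) ℤ.+ (u /ℕ d) ℤ.* + d
      ≡⟨ cong (λ r → + r ℤ.+ (u /ℕ d) ℤ.* + d) (FinP.toℕ-fromℕ< (n%ℕd<d u d)) ⟩
    + (u %ℕ d) ℤ.+ (u /ℕ d) ℤ.* + d
      ≡⟨ a≡a%ℕn+[a/ℕn]*n u d ⟨
    u ∎
    where open ≡-Reasoning

  quotRem-fromQuotRem : ∀ q (i : Fin d) →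
                        fromQuotRem d q i /ℕ d ≡ q × remFin d (fromQuotRem d q i) ≡ i
  quotRem-fromQuotRem q i = fromQuotRem-injective (fromQuotRem-/ℕ-remFin (fromQuotRem d q i))

  <⇒lex-quotRem : ∀ {u w} → u ℤ.< w →
                  u /ℕ d ℤ.< w /ℕ d ⊎ (u /ℕ d ≡ w /ℕ d × remFin d u Fin.< remFin d w)
  <⇒lex-quotRem {u} {w} u<w = fromQuotRem-cancel-<
    (subst₂ ℤ._<_ (sym (fromQuotRem-/ℕ-remFin u)) (sym (fromQuotRem-/ℕ-remFin w)) u<w)

module _ {p p′ : ℕ} .{{_ : NonZero p}} .{{_ : NonZero p′}} (f : Fin p′ → Fin p) where

  laceIndex : ℤ → ℤ
  laceIndex u = fromQuotRem p (u /ℕ p′) (f (remFin p′ u))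

  laceIndex-mono : f Preserves Fin._<_ ⟶ Fin._<_ → laceIndex Preserves ℤ._<_ ⟶ ℤ._<_
  laceIndex-mono f-mono {u} {w} u<w with <⇒lex-quotRem u<w
  ... | inj₁ q<q′ = fromQuotRem-monoˡ-< _ _ q<q′
  ... | inj₂ (q≡q′ , i<j) = subst (λ q → laceIndex u ℤ.< fromQuotRem p q (f (remFin p′ w)))
                                  q≡q′ (fromQuotRem-monoʳ-< (u /ℕ p′) (f-mono i<j))

module _ (ℝ : RealField) where
  open RealField ℝ
  open WithReals ℝ

  sumFin-cong : ∀ {n} {a b : Fin n → Carrier} → (∀ i → a i ≡ b i) → sumFin a ≡ sumFin b
  sumFin-cong {ℕ.zero}  eq = refl
  sumFin-cong {ℕ.suc n} eq = cong₂ _+_ (eq Fin.zero) (sumFin-cong (λ i → eq (Fin.suc i)))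

  det-cong : ∀ {n} {M N : Fin n → Fin n → Carrier} → (∀ i j → M i j ≡ N i j) → det M ≡ det N
  det-cong {ℕ.zero}  eq = refl
  det-cong {ℕ.suc n} eq = sumFin-cong λ j →
    cong₂ (λ a b → sign (Fin.toℕ j) * (a * b)) (eq Fin.zero j)
          (det-cong (λ i k → eq (Fin.suc i) (Fin.punchIn j k)))

  TotallyPositive-resp : ∀ {M N : ℤ → ℤ → Carrier} → (∀ u v → M u v ≡ N u v) →
                         TotallyPositive M → TotallyPositive N
  TotallyPositive-resp M≡N tp k r c r-inc c-inc =
    subst (0# ≤_) (det-cong (λ i j → M≡N (r i) (c j))) (tp k r c r-inc c-inc)

  TotallyPositive-reindex : ∀ {M : ℤ → ℤ → Carrier} {φ ψ : ℤ → ℤ} → TotallyPositive M →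
                            φ Preserves ℤ._<_ ⟶ ℤ._<_ → ψ Preserves ℤ._<_ ⟶ ℤ._<_ →
                            TotallyPositive (λ u v → M (φ u) (ψ v))
  TotallyPositive-reindex tp φ-mono ψ-mono k r c r-inc c-inc =
    tp k _ _ (λ i j i<j → φ-mono (r-inc i j i<j)) (λ i j i<j → ψ-mono (c-inc i j i<j))

  Lace-submatrix : ∀ {p q p′ q′} .{{_ : NonZero p}} .{{_ : NonZero q}}
                   .{{_ : NonZero p′}} .{{_ : NonZero q′}}
                   (A : Fin p → Fin q → PowerSeries) (f : Fin p′ → Fin p) (g : Fin q′ → Fin q) →
                   ∀ u v → Lace A (laceIndex f u) (laceIndex g v) ≡ Lace (λ i j → A (f i) (g j)) u v
  Lace-submatrix {p} {q} {p′} {q′} A f g u v =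
    cong₂ coeff (cong₂ A (proj₂ row) (proj₂ column)) (cong₂ ℤ._-_ (proj₁ column) (proj₁ row))
    where
    row : laceIndex f u /ℕ p ≡ u /ℕ p′ × remFin p (laceIndex f u) ≡ f (remFin p′ u)
    row = quotRem-fromQuotRem (u /ℕ p′) (f (remFin p′ u))
    column : laceIndex g v /ℕ q ≡ v /ℕ q′ × remFin q (laceIndex g v) ≡ g (remFin q′ v)
    column = quotRem-fromQuotRem (v /ℕ q′) (g (remFin q′ v))

proposition3p8 : (ℝ : RealField) → let open WithReals ℝ in
    ∀ {p q} .{{_ : NonZero p}} .{{_ : NonZero q}} (A : Fin p → Fin q → PowerSeries) →
    FullyInterlacing A →
    ∀ {p′ q′} .{{_ : NonZero p′}} .{{_ : NonZero q′}} (f : Fin p′ → Fin p) (g : Fin q′ → Fin q) →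
    IncreasingInFin f → IncreasingInFin g →
    FullyInterlacing (λ i j → A (f i) (g j))
proposition3p8 ℝ A A-tp f g f-inc g-inc =
  TotallyPositive-resp ℝ (Lace-submatrix ℝ A f g)
    (TotallyPositive-reindex ℝ {M = WithReals.Lace ℝ A} A-tp
      (laceIndex-mono f (f-inc _ _)) (laceIndex-mono g (g-inc _ _)))
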